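{- Let $\alpha$ be a square-free positive rational number and let $\mathcal T_1=(T_1,\nu_1)$ and $\mathcal T_2=(T_2,\nu_2)$ be factorization trees for $\alpha$. Then $\nu_1(V(T_1))=\nu_2(V(T_2))$ if and only if $\mathcal T_1\cong\mathcal T_2$. In this case (where $\nu_2$ is injective), the map $\nu_2^{ -1}\circ\nu_1:V(T_1)\to V(T_2)$ is an isomorphism.
   Context: Write $\alpha=a/b$ with $a,b$ coprime positive integers; $\alpha$ is square-free if $a$ and $b$ are both square-free. Let $p_1\ge\cdots\ge p_N$ be the primes dividing $ab$, listed with multiplicity. Put $\gamma(i)=1$ if $p_i\mid a$, $\gamma(i)=-1$ if $p_i\mid b$, and $\alpha_n=\prod_{i=1}^n p_i^{\gamma(i)}$ for $0\le n\le N$. A factorization of a positive rational $\beta$ is a sequence $(a_1/b_1,a_2/b_2,\dots)$ with $a_i,b_i$ positive integers, $a_i=b_i=1$ for all but finitely many $i$, $\prod_i a_i/b_i=\beta$, $\max\{a_i,b_i\}\ge\max\{a_{i+1},b_{i+1}\}$ for all $i$, and $\gcd(a_i,b_j)=1$ for all $i,j$. Let $\mathfrak F_\alpha$ be the set of factorizations of $\alpha_n$, $0\le n\le N$. For $0\le n<N$, a factorization $(a_i/b_i)$ of $\alpha_n$ is a direct subfactorization of a factorization $(c_i/d_i)$ of $\alpha_{n+1}$ if either $p_{n+1}\mid a$ and for some $k$: $d_i=b_i$ for all $i$, $c_i=a_i$ for $i\ne k$, $c_k=a_kp_{n+1}$; or $p_{n+1}\mid b$ and for some $k$: $c_i=a_i$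 for all $i$, $d_i=b_i$ for $i\ne k$, $d_k=b_kp_{n+1}$. A factorization tree for $\alpha$ is a pair $(T,\nu)$ with $T$ a rooted tree (digraph with edges from each vertex to its children) and $\nu:V(T)\to\mathfrak F_\alpha$, with parenting map $\phi$, such that: (1) the root $r_0$ has $\nu(r_0)=(1,1,\dots)$; (2) if $n<N$ and $\nu(r)$ is a factorization of $\alpha_n$ then $r$ has a child; (3) $\nu(r)=\nu(s)$ and $\phi(r)=\phi(s)$ imply $r=s$; (4) for non-root $r$, $\nu(\phi(r))$ is a direct subfactorization of $\nu(r)$. An isomorphism $(T_1,\nu_1)\to(T_2,\nu_2)$ is a bijection $\sigma:V(T_1)\to V(T_2)$ with $\nu_2\circ\sigma=\nu_1$ and $(g,h)\in E(T_1)\iff(\sigma(g),\sigma(h))\in E(T_2)$; $\cong$ means one exists. -}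

module Defs where

open import Data.Nat using (ℕ; zero; suc; _*_; _≤_; _<_; _≥_; _⊔_)
open import Data.Nat.Divisibility using (_∣_; _∣?_)
open import Data.Nat.Coprimality using (Coprime)
open import Data.Nat.Primality using (Prime)
open import Data.List using (List; []; _∷_; length; filter; take; map)
open import Data.Nat.ListAction using (product)
open import Data.List.Relation.Unary.Linked using (Linked)
open import Data.List.Membership.Propositional using (_∈_)
open import Data.Maybe using (Maybe; just; nothing)
open import Data.Product using (_×_; _,_; proj₁; proj₂; Σ; ∃; ∃-syntax)
open import Data.Empty using (⊥)
open import Relation.Nullary using (¬_)
open import Relation.Binary.PropositionalEquality using (_≡_; _≢_)
open import Function.Definitions using (Injective; Surjective)

SquareFree : ℕ → Set
SquareFree n = ∀ p → Prime p → ¬ (p * p ∣ n)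

-- A factorization (a₁/b₁, a₂/b₂, …) is represented by the finite list of its
-- entries that differ from 1/1 (all later entries are 1/1).
Seq : Set
Seq = List (ℕ × ℕ)

entry : Seq → ℕ → ℕ × ℕ
entry []       _       = 1 , 1
entry (x ∷ xs) zero    = x
entry (x ∷ xs) (suc i) = entry xs i

nth : List ℕ → ℕ → ℕ
nth []       _       = 1
nth (x ∷ xs) zero    = x
nth (x ∷ xs) (suc i) = nth xs i

NonTrivial : ℕ × ℕ → Set
NonTrivial (x , y) = ¬ ((x ≡ 1) × (y ≡ 1))

IsFactorizationOf : ℕ → ℕ → Seq → Set
IsFactorizationOf c d L =
    (∀ e → e ∈ L → 1 ≤ proj₁ e × 1 ≤ proj₂ e × NonTrivial e)
  × (product (map proj₁ L) * d ≡ product (map proj₂ L) * c)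
  × Linked (λ e f → proj₁ f ⊔ proj₂ f ≤ proj₁ e ⊔ proj₂ e) L
  × (∀ e f → e ∈ L → f ∈ L → Coprime (proj₁ e) (proj₂ f))

-- Everything relative to α = a/b with p₁ ≥ … ≥ p_N the list ps.
module Setup (a b : ℕ) (ps : List ℕ) where

  N : ℕ
  N = length ps

  -- α_n = num n / den n
  num : ℕ → ℕ
  num n = product (filter (λ p → p ∣? a) (take n ps))

  den : ℕ → ℕ
  den n = product (filter (λ p → p ∣? b) (take n ps))

  -- p_{n+1} (1-based in the paper) = nth ps n
  prime : ℕ → ℕ
  prime n = nth ps n

  InFα : Seq → Set
  InFα F = ∃[ n ] (n ≤ N × IsFactorizationOf (num n) (den n) F)

  DirectSub : Seq → Seq → Set
  DirectSub F G = ∃[ n ] (n < N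
    × IsFactorizationOf (num n) (den n) F
    × IsFactorizationOf (num (suc n)) (den (suc n)) G
    × (  (prime n ∣ a × ∃[ k ] (  (∀ i → proj₂ (entry G i) ≡ proj₂ (entry F i))
                                × (∀ i → i ≢ k → proj₁ (entry G i) ≡ proj₁ (entry F i))
                                × proj₁ (entry G k) ≡ proj₁ (entry F k) * prime n))
       ⊎' (prime n ∣ b × ∃[ k ] (  (∀ i → proj₁ (entry G i) ≡ proj₁ (entry F i))
                                × (∀ i → i ≢ k → proj₂ (entry G i) ≡ proj₂ (entry F i))
                                × proj₂ (entry G k) ≡ proj₂ (entry F k) * prime n))))
    where open import Data.Sum using () renaming (_⊎_ to _⊎'_)

  data ReachesRoot {V : Set} (root : V) (parent : V → Maybe V) : V → Set where
    atRoot : ReachesRoot root parent root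
    step   : ∀ {v u} → parent v ≡ just u → ReachesRoot root parent u
           → ReachesRoot root parent v

  -- A factorization tree for α.  The rooted tree is given by its vertex type,
  -- root and parenting map φ; the edges are (φ h , h).
  record FactorizationTree : Set₁ where
    field
      V          : Set
      root       : V
      φ          : V → Maybe V
      φ-root     : φ root ≡ nothing
      φ-nonroot  : ∀ v → φ v ≡ nothing → v ≡ root
      rooted     : ∀ v → ReachesRoot root φ v
      ν          : V → Seq
      ν-in       : ∀ v → InFα (ν v)
      cond1      : ν root ≡ []
      cond2      : ∀ r n → n < N → IsFactorizationOf (num n) (den n) (ν r)
                   → ∃[ s ] (φ s ≡ just r)
      cond3      : ∀ r s → ν r ≡ ν s → φ r ≡ φ s → r ≡ s
      cond4      : ∀ r q → φ r ≡ just q → DirectSub (ν q) (ν r)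

    Edge : V → V → Set
    Edge g h = φ h ≡ just g

  open FactorizationTree

  IsIso : (T₁ T₂ : FactorizationTree) → (V T₁ → V T₂) → Set
  IsIso T₁ T₂ σ =
      Injective _≡_ _≡_ σ × Surjective _≡_ _≡_ σ
    × (∀ v → ν T₂ (σ v) ≡ ν T₁ v)
    × (∀ g h → (Edge T₁ g h → Edge T₂ (σ g) (σ h)) × (Edge T₂ (σ g) (σ h) → Edge T₁ g h))

  _≅_ : FactorizationTree → FactorizationTree → Set
  T₁ ≅ T₂ = Σ (V T₁ → V T₂) (IsIso T₁ T₂)

  SameImage : FactorizationTree → FactorizationTree → Set
  SameImage T₁ T₂ = (∀ u → ∃[ v ] (ν T₂ v ≡ ν T₁ u)) × (∀ v → ∃[ u ] (ν T₁ u ≡ ν T₂ v))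

-- Everything rests on two uniqueness facts, valid for square-free α:
--   (A) a sequence is a factorization of at most one α_n, because the α_n
--       are pairwise distinct: passing from α_m to α_{m'} (m < m') brings in
--       the prime p_{m+1}, which lands in exactly one of numerator and
--       denominator since a and b are coprime;
--   (B) a factorization has at most one direct subfactorization (by (A) the
--       removed prime p_{n+1} is determined, and it sits in only one entry
--       because α_{n+1} is square-free), and (1,1,…) has none.
-- From (B), induction along the path to the root shows that the labelling
-- ν of any factorization tree is injective, and that the parent of a vertex
-- is the unique vertex carrying the unique direct subfactorization of its
-- label.  Hence every label-preserving map between trees preserves and
-- reflects edges; with equal label sets it is a bijection, i.e. an
-- isomorphism.  Conversely an isomorphism preserves labels, hence images.
module Submission where

open import Defs
open import Data.Nat using (ℕ; zero; suc; _*_; _+_; _≤_; _<_; _≥_; s≤s; z<s; NonZero; >-nonZero)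
open import Data.Nat.Properties
  using (_≟_; *-comm; *-assoc; +-suc; *-cancelˡ-≡; *-cancelʳ-≡; m*n≢0; <-cmp; <-≤-trans; m<m+n; m≤n⇒∃[o]m+o≡n)
open import Data.Nat.Divisibility
  using (_∣_; _∣?_; divides; ∣-trans; ∣-refl; ∣-reflexive; ∣1⇒≡1; 1∣_; *-pres-∣; *-monoʳ-∣; *-cancelʳ-∣; m∣m*n; ∣m⇒∣m*n; ∣n⇒∣m*n)
open import Data.Nat.Coprimality using (Coprime)
import Data.Nat.Coprimality as Coprime
open import Data.Nat.Primality using (Prime; euclidsLemma; ¬prime[1]; prime⇒nonZero; productOfPrimes≢0)
open import Data.List using (List; []; _∷_; _++_; filter; take; drop; map; length)
open import Data.List.Properties using (take-[]; filter-++)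
open import Data.Nat.ListAction using (product)
open import Data.Nat.ListAction.Properties using (product-++; product≢0; ∈⇒∣product)
open import Data.List.Membership.Propositional using (_∈_)
open import Data.List.Relation.Unary.Any using (here; there)
open import Data.List.Relation.Unary.All using (All; []; _∷_)
import Data.List.Relation.Unary.All as All
open import Data.List.Relation.Unary.All.Properties using (all-filter; filter⁺; take⁺; map⁺)
open import Data.List.Relation.Unary.Linked using (Linked)
open import Data.Maybe using (just; nothing)
open import Data.Product using (_×_; _,_; proj₁; proj₂; ∃-syntax)
open import Data.Sum using (_⊎_; inj₁; inj₂)
open import Data.Empty using (⊥-elim)
open import Data.Nat.Tactic.RingSolver using (solve-∀)
open import Function.Bundles using (_⇔_; mk⇔)
open import Function.Definitions using (Injective)
open import Relation.Nullary using (¬_; yes; no)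
open import Relation.Binary.Definitions using (tri<; tri≈; tri>)
open import Relation.Binary.PropositionalEquality
  using (_≡_; _≢_; refl; sym; trans; cong; cong₂; subst; subst₂; module ≡-Reasoning)

prime∤1 : ∀ {p} → Prime p → ¬ p ∣ 1
prime∤1 pp p∣1 = ¬prime[1] (subst Prime (∣1⇒≡1 p∣1) pp)

prime∤coprime : ∀ {p x y} → Prime p → p ∣ x → p ∣ y → ¬ Coprime x y
prime∤coprime pp p∣x p∣y cop = ¬prime[1] (subst Prime (cop (p∣x , p∣y)) pp)

prime∣product-map : ∀ {p} {A : Set} (g : A → ℕ) (L : List A) → Prime p
  → p ∣ product (map g L) → ∃[ e ] (e ∈ L × p ∣ g e)
prime∣product-map g []      pp p∣1 = ⊥-elim (prime∤1 pp p∣1)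
prime∣product-map g (x ∷ L) pp p∣ with euclidsLemma (g x) (product (map g L)) pp p∣
... | inj₁ p∣gx = x , here refl , p∣gx
... | inj₂ p∣rest with prime∣product-map g L pp p∣rest
...   | e , e∈L , p∣ge = e , there e∈L , p∣ge

square∣-cancelˡ : ∀ {p y x} → Prime p → ¬ p ∣ y → p * p ∣ y * x → p * p ∣ x
square∣-cancelˡ {p} {y} {x} pp p∤y p²∣yx with euclidsLemma y x pp (∣-trans (m∣m*n p) p²∣yx)
... | inj₁ p∣y = ⊥-elim (p∤y p∣y)
... | inj₂ (divides q refl) = *-pres-∣ p∣q (∣-refl {p})
  where
  p∣yq : p ∣ y * q
  p∣yq = *-cancelʳ-∣ p {{prime⇒nonZero pp}} (subst (p * p ∣_) (sym (*-assoc y q p)) p²∣yx)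
  p∣q : p ∣ q
  p∣q with euclidsLemma y q pp p∣yq
  ... | inj₁ p∣y = ⊥-elim (p∤y p∣y)
  ... | inj₂ p∣q = p∣q

square∤squareFree-product : ∀ {p x y} → Prime p → SquareFree x → Coprime x y
  → p ∣ x → ¬ p * p ∣ x * y
square∤squareFree-product {p} {x} {y} pp sf cop p∣x p²∣xy =
  sf p pp (square∣-cancelˡ pp (λ p∣y → prime∤coprime pp p∣x p∣y cop)
                           (subst (p * p ∣_) (*-comm x y) p²∣xy))

*-shuffle : ∀ x y z w → (x * y) * (z * w) ≡ (y * z) * (x * w)
*-shuffle = solve-∀

*-swapʳ : ∀ x y z → x * y * z ≡ x * z * y
*-swapʳ = solve-∀

entry-∈ : ∀ G k → entry G k ∈ G ⊎ entry G k ≡ (1 , 1)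
entry-∈ []      k       = inj₂ refl
entry-∈ (x ∷ G) zero    = inj₁ (here refl)
entry-∈ (x ∷ G) (suc k) with entry-∈ G k
... | inj₁ e∈G = inj₁ (there e∈G)
... | inj₂ e≡1 = inj₂ e≡1

entry∣product : (g : ℕ × ℕ → ℕ) → g (1 , 1) ≡ 1 → ∀ G k
  → g (entry G k) ∣ product (map g G)
entry∣product g g1 []      k       = ∣-reflexive g1
entry∣product g g1 (x ∷ G) zero    = m∣m*n _
entry∣product g g1 (x ∷ G) (suc k) = ∣n⇒∣m*n (g x) (entry∣product g g1 G k)

entries∣product : (g : ℕ × ℕ → ℕ) → g (1 , 1) ≡ 1 → ∀ G k k' → k ≢ k'
  → g (entry G k) * g (entry G k') ∣ product (map g G)
entries∣product g g1 []      k       k'       _    = ∣-reflexive (cong₂ _*_ g1 g1)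
entries∣product g g1 (x ∷ G) zero    zero     k≢k' = ⊥-elim (k≢k' refl)
entries∣product g g1 (x ∷ G) zero    (suc k') _    = *-monoʳ-∣ (g x) (entry∣product g g1 G k')
entries∣product g g1 (x ∷ G) (suc k) zero     _    =
  subst (_∣ g x * product (map g G)) (*-comm (g x) _) (*-monoʳ-∣ (g x) (entry∣product g g1 G k))
entries∣product g g1 (x ∷ G) (suc k) (suc k') k≢k' =
  ∣n⇒∣m*n (g x) (entries∣product g g1 G k k' (λ k≡k' → k≢k' (cong suc k≡k')))

entry-ext : ∀ F F' → (∀ e → e ∈ F → NonTrivial e) → (∀ e → e ∈ F' → NonTrivial e)
  → (∀ i → entry F i ≡ entry F' i) → F ≡ F'
entry-ext []      []       _  _   _   = refl
entry-ext []      (y ∷ F') _  nt' eqs = ⊥-elim (nt' y (here refl) (cong proj₁ (sym (eqs 0)) , cong proj₂ (sym (eqs 0))))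
entry-ext (x ∷ F) []       nt _   eqs = ⊥-elim (nt x (here refl) (cong proj₁ (eqs 0) , cong proj₂ (eqs 0)))
entry-ext (x ∷ F) (y ∷ F') nt nt' eqs =
  cong₂ _∷_ (eqs 0) (entry-ext F F' (λ e e∈ → nt e (there e∈)) (λ e e∈ → nt' e (there e∈)) (λ i → eqs (suc i)))

nonTrivial : ∀ {c d F} → IsFactorizationOf c d F → ∀ e → e ∈ F → NonTrivial e
nonTrivial (pos , _) e e∈F = proj₂ (proj₂ (pos e e∈F))

sides≢0 : ∀ {c d F} → IsFactorizationOf c d F
  → NonZero (product (map proj₁ F)) × NonZero (product (map proj₂ F))
sides≢0 {F = F} (pos , _) =
    product≢0 (map⁺ (All.tabulate {xs = F} (λ {e} e∈F → >-nonZero (proj₁ (pos e e∈F)))))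
  , product≢0 (map⁺ (All.tabulate {xs = F} (λ {e} e∈F → >-nonZero (proj₁ (proj₂ (pos e e∈F))))))

factorization-ratio : ∀ {c d c' d' G} → IsFactorizationOf c d G → IsFactorizationOf c' d' G
  → c * d' ≡ c' * d
factorization-ratio {c} {d} {c'} {d'} {G} fG@(_ , Ad≡Bc , _) (_ , Ad'≡Bc' , _) =
  *-cancelˡ-≡ (c * d') (c' * d) (A * B) {{m*n≢0 A B {{proj₁ (sides≢0 fG)}} {{proj₂ (sides≢0 fG)}}}} (begin
    (A * B) * (c * d')   ≡⟨ *-shuffle A B c d' ⟩
    (B * c) * (A * d')   ≡⟨ cong₂ _*_ (sym Ad≡Bc) Ad'≡Bc' ⟩
    (A * d) * (B * c')   ≡⟨ *-comm (A * d) (B * c') ⟩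
    (B * c') * (A * d)   ≡⟨ sym (*-shuffle A B c' d) ⟩
    (A * B) * (c' * d)   ∎)
  where
  open ≡-Reasoning
  A = product (map proj₁ G)
  B = product (map proj₂ G)

-- This is the
-- shape of a direct subfactorization on the side where p_{n+1} goes.
record Bump (g : ℕ × ℕ → ℕ) (p k : ℕ) (F G : Seq) : Set where
  constructor mkBump
  field
    unchanged : ∀ i → i ≢ k → g (entry G i) ≡ g (entry F i)
    bumped    : g (entry G k) ≡ g (entry F k) * p

bump-injective : ∀ {p k F F' G} (g : ℕ × ℕ → ℕ) → Prime p → Bump g p k F G → Bump g p k F' G
  → ∀ i → g (entry F i) ≡ g (entry F' i)
bump-injective {k = k} g pp (mkBump same bumped) (mkBump same' bumped') i with i ≟ k
... | yes refl = *-cancelʳ-≡ _ _ _ {{prime⇒nonZero pp}} (trans (sym bumped) bumped')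
... | no i≢k   = trans (sym (same i i≢k)) (same' i i≢k)

bumps-apart⇒square : ∀ {p k k' F F' G} (g : ℕ × ℕ → ℕ) → g (1 , 1) ≡ 1 → Bump g p k F G → Bump g p k' F' G
  → k ≢ k' → p * p ∣ product (map g G)
bumps-apart⇒square {k = k} {k'} {F} {F'} {G} g g1 (mkBump _ bumped) (mkBump _ bumped') k≢k' =
  ∣-trans (*-pres-∣ (divides (g (entry F k)) bumped) (divides (g (entry F' k')) bumped'))
          (entries∣product g g1 G k k' k≢k')

square-transfer : ∀ {p u w k} (g h : ℕ × ℕ → ℕ) (G : Seq) → g (1 , 1) ≡ 1 → Prime p
  → (∀ e f → e ∈ G → f ∈ G → Coprime (g e) (h f)) → p ∣ g (entry G k)
  → product (map g G) * u ≡ product (map h G) * w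
  → p * p ∣ product (map g G) → p * p ∣ w
square-transfer {p} {u} {k = k} g h G g1 pp coprime p∣gk eqn p²∣G =
  square∣-cancelˡ pp p∤hG (subst (p * p ∣_) eqn (∣m⇒∣m*n u p²∣G))
  where
  p∤hG : ¬ p ∣ product (map h G)
  p∤hG p∣hG with prime∣product-map h G pp p∣hG | entry-∈ G k
  ... | f , f∈G , p∣hf | inj₁ ek∈G = prime∤coprime pp p∣gk p∣hf (coprime _ f ek∈G f∈G)
  ... | _ | inj₂ ek≡1 = prime∤1 pp (subst (p ∣_) (trans (cong g ek≡1) g1) p∣gk)

-- If F and F' both arise from G by bumping the g-side by a prime p of a
-- square-free x, where w | x·y carries the g-side of G, the positions of the
-- bumps coincide (else p² | x·y), so F and F' have the same g-coordinates.
bump-parents-agree : ∀ {p x y u w k k' F F'} (g h : ℕ × ℕ → ℕ) (G : Seq) → g (1 , 1) ≡ 1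
  → Prime p → SquareFree x → Coprime x y → p ∣ x → w ∣ x * y
  → (∀ e f → e ∈ G → f ∈ G → Coprime (g e) (h f))
  → product (map g G) * u ≡ product (map h G) * w
  → Bump g p k F G → Bump g p k' F' G → ∀ i → g (entry F i) ≡ g (entry F' i)
bump-parents-agree {k = k} {k'} {F} g h G g1 pp sf cop p∣x w∣xy coprime eqn bump bump' with k ≟ k'
... | yes refl = bump-injective g pp bump bump'
... | no k≢k'  = ⊥-elim (square∤squareFree-product pp sf cop p∣x
    (∣-trans (square-transfer g h G g1 pp coprime (divides (g (entry F k)) (Bump.bumped bump)) eqn
               (bumps-apart⇒square g g1 bump bump' k≢k')) w∣xy))

prodDividing : ℕ → List ℕ → ℕ
prodDividing c xs = product (filter (λ q → q ∣? c) xs)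

take-+ : ∀ {A : Set} m d (xs : List A) → take (m + d) xs ≡ take m xs ++ take d (drop m xs)
take-+ zero    d xs       = refl
take-+ (suc m) d []       = sym (take-[] d)
take-+ (suc m) d (x ∷ xs) = cong (x ∷_) (take-+ m d xs)

prodDividing-take-+ : ∀ c m d xs
  → prodDividing c (take (m + d) xs) ≡ prodDividing c (take m xs) * prodDividing c (take d (drop m xs))
prodDividing-take-+ c m d xs = begin
  product (filter P? (take (m + d) xs))                       ≡⟨ cong (λ ys → product (filter P? ys)) (take-+ m d xs) ⟩
  product (filter P? (take m xs ++ seg))                      ≡⟨ cong product (filter-++ P? (take m xs) seg) ⟩
  product (filter P? (take m xs) ++ filter P? seg)            ≡⟨ product-++ (filter P? (take m xs)) (filter P? seg) ⟩
  product (filter P? (take m xs)) * product (filter P? seg)   ∎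
  where
  open ≡-Reasoning
  P? = λ q → q ∣? c
  seg = take d (drop m xs)

prodDividing-take∣product : ∀ c m xs → prodDividing c (take m xs) ∣ product xs
prodDividing-take∣product c zero    xs       = 1∣ product xs
prodDividing-take∣product c (suc m) []       = ∣-refl
prodDividing-take∣product c (suc m) (x ∷ xs) with x ∣? c
... | yes _ = *-monoʳ-∣ x (prodDividing-take∣product c m xs)
... | no _  = ∣n⇒∣m*n x (prodDividing-take∣product c m xs)

prime∣prodDividing : ∀ {p c} xs → Prime p → p ∣ prodDividing c xs → p ∣ c
prime∣prodDividing {p} {c} xs pp = go (filter (λ q → q ∣? c) xs) (all-filter (λ q → q ∣? c) xs)
  where
  go : ∀ ys → All (_∣ c) ys → p ∣ product ys → p ∣ c
  go []       _            p∣1 = ⊥-elim (prime∤1 pp p∣1)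
  go (y ∷ ys) (y∣c ∷ ys∣c) p∣ with euclidsLemma y (product ys) pp p∣
  ... | inj₁ p∣y = ∣-trans p∣y y∣c
  ... | inj₂ p∣ys = go ys ys∣c p∣ys

head∣prodDividing : ∀ {c} x xs → x ∣ c → x ∣ prodDividing c (x ∷ xs)
head∣prodDividing {c} x xs x∣c with x ∣? c
... | yes _   = m∣m*n _
... | no x∤c  = ⊥-elim (x∤c x∣c)

-- For coprime a, b, a nonempty list of primes dividing a·b has different
-- a-part and b-part: its first prime lies in exactly one of them.
parts-differ : ∀ {a b p} xs → Coprime a b → Prime p → p ∣ a * b
  → prodDividing a (p ∷ xs) ≢ prodDividing b (p ∷ xs)
parts-differ {a} {b} {p} xs cop pp p∣ab parts≡ with euclidsLemma a b pp p∣ab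
... | inj₁ p∣a = prime∤coprime pp p∣a
    (prime∣prodDividing (p ∷ xs) pp (subst (p ∣_) parts≡ (head∣prodDividing p xs p∣a))) cop
... | inj₂ p∣b = prime∤coprime pp
    (prime∣prodDividing (p ∷ xs) pp (subst (p ∣_) (sym parts≡) (head∣prodDividing p xs p∣b))) p∣b cop

drop-∷ : ∀ {A : Set} (xs : List A) m → m < length xs → ∃[ x ] ∃[ r ] (drop m xs ≡ x ∷ r × x ∈ xs)
drop-∷ (x ∷ xs) zero    _       = x , xs , refl , here refl
drop-∷ (x ∷ xs) (suc m) (s≤s m<) with drop-∷ xs m m<
... | y , r , drop≡ , y∈ = y , r , drop≡ , there y∈

nth-All : ∀ {P : ℕ → Set} xs n → All P xs → n < length xs → P (nth xs n)
nth-All (x ∷ xs) zero    (px ∷ _)   _       = px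
nth-All (x ∷ xs) (suc n) (_  ∷ pxs) (s≤s n<) = nth-All xs n pxs n<

<⇒+suc : ∀ {m n} → m < n → ∃[ o ] (m + suc o ≡ n)
<⇒+suc {m} m<n with m≤n⇒∃[o]m+o≡n m<n
... | o , sm+o≡n = o , trans (+-suc m o) sm+o≡n

module FactorizationTheory (a b : ℕ) (cop : Coprime a b) (sfa : SquareFree a) (sfb : SquareFree b)
  (ps : List ℕ) (allPrime : All Prime ps) (prodEq : product ps ≡ a * b) where

  open Setup a b ps
  open FactorizationTree

  prime-isPrime : ∀ {n} → n < N → Prime (prime n)
  prime-isPrime {n} = nth-All ps n allPrime

  num∣ab : ∀ m → num m ∣ a * b
  num∣ab m = subst (num m ∣_) prodEq (prodDividing-take∣product a m ps)

  den∣ab : ∀ m → den m ∣ a * b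
  den∣ab m = subst (den m ∣_) prodEq (prodDividing-take∣product b m ps)

  α-distinct : ∀ {m m'} → m < m' → m' ≤ N → num m * den m' ≢ num m' * den m
  α-distinct {m} m<m' m'≤N cross with <⇒+suc m<m'
  ... | o , refl with drop-∷ ps m (<-≤-trans (m<m+n m z<s) m'≤N)
  ...   | p , r , drop≡ , p∈ps =
    parts-differ (take o r) cop (All.lookup allPrime p∈ps) (subst (p ∣_) prodEq (∈⇒∣product p∈ps))
      (subst (λ ys → prodDividing a (take (suc o) ys) ≡ prodDividing b (take (suc o) ys)) drop≡ X≡Y)
    where
    open ≡-Reasoning
    X = prodDividing a (take (suc o) (drop m ps))
    Y = prodDividing b (take (suc o) (drop m ps))
    num≢0 : NonZero (num m)
    num≢0 = productOfPrimes≢0 (filter⁺ _ (take⁺ m allPrime))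
    den≢0 : NonZero (den m)
    den≢0 = productOfPrimes≢0 (filter⁺ _ (take⁺ m allPrime))
    X≡Y : X ≡ Y
    X≡Y = *-cancelˡ-≡ X Y (num m * den m) {{m*n≢0 (num m) (den m) {{num≢0}} {{den≢0}}}} (begin
      num m * den m * X          ≡⟨ *-swapʳ (num m) (den m) X ⟩
      num m * X * den m          ≡⟨ cong (_* den m) (sym (prodDividing-take-+ a m (suc o) ps)) ⟩
      num (m + suc o) * den m    ≡⟨ sym cross ⟩
      num m * den (m + suc o)    ≡⟨ cong (num m *_) (prodDividing-take-+ b m (suc o) ps) ⟩
      num m * (den m * Y)        ≡⟨ sym (*-assoc (num m) (den m) Y) ⟩
      num m * den m * Y          ∎)

  level-unique : ∀ {m m' G} → m ≤ N → m' ≤ N → IsFactorizationOf (num m) (den m) G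
    → IsFactorizationOf (num m') (den m') G → m ≡ m'
  level-unique {m} {m'} m≤N m'≤N fG fG' with <-cmp m m'
  ... | tri< m<m' _ _    = ⊥-elim (α-distinct m<m' m'≤N (factorization-ratio fG fG'))
  ... | tri≈ _ m≡m' _    = m≡m'
  ... | tri> _ _ m'<m    = ⊥-elim (α-distinct m'<m m≤N (factorization-ratio fG' fG))

  -- Both
  -- candidates remove the same prime p_{n+1} (by (A)) from the same side
  -- (a and b are coprime) at the same position (bump-parents-agree).
  direct-sub-unique : ∀ {F F' G} → DirectSub F G → DirectSub F' G → F ≡ F'
  direct-sub-unique {F} {F'} (n , n<N , fF , fG , side) (n' , n'<N , fF' , fG' , side')
    with level-unique n<N n'<N fG fG'
  ... | refl with side | side'
  ... | inj₁ (p∣a , _ , dens , nums , bumped) | inj₁ (_ , _ , dens' , nums' , bumped') =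
    entry-ext F F' (nonTrivial fF) (nonTrivial fF') λ i → cong₂ _,_
      (bump-parents-agree {F = F} {F' = F'} proj₁ proj₂ _ refl (prime-isPrime n<N) sfa cop p∣a (num∣ab (suc n))
         (proj₂ (proj₂ (proj₂ fG))) (proj₁ (proj₂ fG)) (mkBump nums bumped) (mkBump nums' bumped') i)
      (trans (sym (dens i)) (dens' i))
  ... | inj₂ (p∣b , _ , nums , dens , bumped) | inj₂ (_ , _ , nums' , dens' , bumped') =
    entry-ext F F' (nonTrivial fF) (nonTrivial fF') λ i → cong₂ _,_
      (trans (sym (nums i)) (nums' i))
      (bump-parents-agree {F = F} {F' = F'} proj₂ proj₁ _ refl (prime-isPrime n<N) sfb (Coprime.sym cop) p∣b
         (∣-trans (den∣ab (suc n)) (∣-reflexive (*-comm a b)))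
         (λ e f e∈ f∈ → Coprime.sym (proj₂ (proj₂ (proj₂ fG)) f e f∈ e∈)) (sym (proj₁ (proj₂ fG)))
         (mkBump dens bumped) (mkBump dens' bumped') i)
  ... | inj₁ (p∣a , _) | inj₂ (p∣b , _) = ⊥-elim (prime∤coprime (prime-isPrime n<N) p∣a p∣b cop)
  ... | inj₂ (p∣b , _) | inj₁ (p∣a , _) = ⊥-elim (prime∤coprime (prime-isPrime n<N) p∣a p∣b cop)

  -- (B) The trivial factorization (1,1,…) has no direct subfactorization:
  -- its entries are all 1/1, so no entry is a multiple of a prime.
  ¬direct-sub-[] : ∀ {F} → ¬ DirectSub F []
  ¬direct-sub-[] {F} (n , n<N , _ , _ , inj₁ (_ , k , _ , _ , bumped)) =
    prime∤1 (prime-isPrime n<N) (divides (proj₁ (entry F k)) bumped)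
  ¬direct-sub-[] {F} (n , n<N , _ , _ , inj₂ (_ , k , _ , _ , bumped)) =
    prime∤1 (prime-isPrime n<N) (divides (proj₂ (entry F k)) bumped)

  module _ (T : FactorizationTree) where
    parent⇒label≢[] : ∀ {s q} → φ T s ≡ just q → ν T s ≢ []
    parent⇒label≢[] {s} {q} φs≡q νs≡[] = ¬direct-sub-[] (subst (DirectSub (ν T q)) νs≡[] (cond4 T s q φs≡q))

    -- Vertices with equal labels coincide, by induction on the path of r to
    -- the root: equal labels have equal parents by (B) and the induction
    -- hypothesis, and then condition (3) applies.
    ν-injective-along : ∀ {r} → ReachesRoot (root T) (φ T) r → ∀ s → ν T r ≡ ν T s → r ≡ s
    ν-injective-along atRoot s νr≡νs with φ T s in φs
    ... | nothing = sym (φ-nonroot T s φs)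
    ... | just q  = ⊥-elim (parent⇒label≢[] φs (trans (sym νr≡νs) (cond1 T)))
    ν-injective-along {r} (step {u = u} φr u↝root) s νr≡νs with φ T s in φs
    ... | nothing = ⊥-elim (parent⇒label≢[] φr (trans νr≡νs (trans (cong (ν T) (φ-nonroot T s φs)) (cond1 T))))
    ... | just q  = cond3 T r s νr≡νs (trans φr (trans (cong just u≡q) (sym φs)))
      where
      u≡q : u ≡ q
      u≡q = ν-injective-along u↝root q
        (direct-sub-unique (cond4 T r u φr) (subst (DirectSub (ν T q)) (sym νr≡νs) (cond4 T s q φs)))

    ν-injective : Injective _≡_ _≡_ (ν T)
    ν-injective {r} {s} = ν-injective-along (rooted T r) s

  edge-transfer : ∀ (T T' : FactorizationTree) {g h g' h'} → ν T' g' ≡ ν T g → ν T' h' ≡ ν T h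
    → Edge T g h → Edge T' g' h'
  edge-transfer T T' {g} {h} {g'} {h'} νg' νh' φh with φ T' h' in φh'
  ... | nothing = ⊥-elim (parent⇒label≢[] T φh
        (trans (sym νh') (trans (cong (ν T') (φ-nonroot T' h' φh')) (cond1 T'))))
  ... | just x  = cong just (ν-injective T'
        (direct-sub-unique (cond4 T' h' x φh') (subst₂ DirectSub (sym νg') (sym νh') (cond4 T h g φh))))

  label-preserving⇒iso : ∀ (T₁ T₂ : FactorizationTree) → SameImage T₁ T₂
    → (σ : V T₁ → V T₂) → (∀ u → ν T₂ (σ u) ≡ ν T₁ u) → IsIso T₁ T₂ σ
  label-preserving⇒iso T₁ T₂ (_ , covered) σ preserves =
    σ-injective , σ-surjective , preserves ,
    λ g h → edge-transfer T₁ T₂ (preserves g) (preserves h)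
          , edge-transfer T₂ T₁ (sym (preserves g)) (sym (preserves h))
    where
    σ-injective : ∀ {x y} → σ x ≡ σ y → x ≡ y
    σ-injective {x} {y} σx≡σy = ν-injective T₁ (trans (sym (preserves x)) (trans (cong (ν T₂) σx≡σy) (preserves y)))
    σ-surjective : ∀ v → ∃[ u ] (∀ {z} → z ≡ u → σ z ≡ v)
    σ-surjective v with covered v
    ... | u , νu≡νv = u , λ { refl → ν-injective T₂ (trans (preserves u) νu≡νv) }

  iso⇒sameImage : ∀ (T₁ T₂ : FactorizationTree) → T₁ ≅ T₂ → SameImage T₁ T₂
  iso⇒sameImage T₁ T₂ (σ , _ , σ-surjective , preserves , _) =
    (λ u → σ u , preserves u) ,
    (λ v → let (u , σu≡v) = σ-surjective v in u , trans (sym (preserves u)) (cong (ν T₂) (σu≡v refl)))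

-- Theorem 3.3, with σ = ν₂⁻¹ ∘ ν₁ read off from the inclusion ν₁(V(T₁)) ⊆ ν₂(V(T₂)).
theorem3p3 : (a b : ℕ) → 1 ≤ a → 1 ≤ b → Coprime a b → SquareFree a → SquareFree b
    → (ps : List ℕ) → All Prime ps → Linked _≥_ ps → product ps ≡ a * b
    → (T₁ T₂ : Setup.FactorizationTree a b ps)
    → (Setup.SameImage a b ps T₁ T₂ ⇔ Setup._≅_ a b ps T₁ T₂)
      × (Setup.SameImage a b ps T₁ T₂
         → Injective _≡_ _≡_ (Setup.FactorizationTree.ν T₂)
           × ((σ : Setup.FactorizationTree.V T₁ → Setup.FactorizationTree.V T₂)
              → (∀ u → Setup.FactorizationTree.ν T₂ (σ u) ≡ Setup.FactorizationTree.ν T₁ u)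
              → Setup.IsIso a b ps T₁ T₂ σ))
theorem3p3 a b _ _ cop sfa sfb ps allPrime _ prodEq T₁ T₂ =
  mk⇔ sameImage⇒iso (iso⇒sameImage T₁ T₂) ,
  λ same → ν-injective T₂ , label-preserving⇒iso T₁ T₂ same
  where
  open FactorizationTheory a b cop sfa sfb ps allPrime prodEq
  open Setup a b ps using (SameImage; _≅_)
  sameImage⇒iso : SameImage T₁ T₂ → T₁ ≅ T₂
  sameImage⇒iso same@(included , _) =
    (λ u → proj₁ (included u)) , label-preserving⇒iso T₁ T₂ same _ (λ u → proj₂ (included u))
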